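{- For every typing context $\Gamma$, $\lambda$-term $M$ and type $A$: $\Gamma\vdash_{s\omega} M:A$ is derivable in $\Lambda_{\cap\omega}^s$ if and only if $\Gamma\vdash_{\ell\omega} M:A$ is derivable in $\Lambda_{\cap\omega}^\ell$.
   Context: $\lambda$-terms: $M::=x\mid MM\mid\lambda x.M$ modulo $\alpha$-conversion; $M[x:=N]$ capture-avoiding substitution. Types: $A::=\varphi\mid\omega\mid A\to A\mid A\cap A$. A typing context is a finite set of pairs $x:A$, where a variable may occur with several types; $\Gamma,x:A$ denotes $\Gamma\cup\{x:A\}$; $x\notin\Gamma$ means no $x:C$ lies in $\Gamma$. $\Lambda_{\cap\omega}^s$ ($n\ge0$): (Ax) $\Gamma,x:A\vdash x:A$; $(\mathsf{Beta})^s$ from $\Gamma\vdash M[x:=N]N_1\dots N_n:A$ and $\Gamma\vdash N:B$ infer $\Gamma\vdash(\lambda x.M)NN_1\dots N_n:A$; $(\mathsf{L}\to)$ from $\Gamma\vdash N:A_1$ and $\Gamma,y:A_2\vdash yN_1\dots N_n:B$, with $y\notin FV(N_1)\cup\dots\cup FV(N_n)$, $y\notin\Gamma$, infer $\Gamma,x:A_1\to A_2\vdash xNN_1\dots N_n:B$; $(\mathsf{R}\to)$ from $\Gamma,x:A\vdash M:B$, $x\notin\Gamma$, infer $\Gamma\vdash\lambda x.M:A\to B$; $(\mathsf{L}\cap)$ from $\Gamma,x:A_1,x:A_2\vdash xN_1\dots N_n:B$ infer $\Gamma,x:A_1\cap A_2\vdash xN_1\dots N_n:B$; $(\mathsf{R}\cap)$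 from $\Gamma\vdash M:A$ and $\Gamma\vdash M:B$ infer $\Gamma\vdash M:A\cap B$; $(\omega)$ $\Gamma\vdash M:\omega$. $\Lambda_{\cap\omega}^\ell$ is the same system with $(\mathsf{Beta})^s$ replaced by $(\mathsf{Beta})^\ell$: from $\Gamma\vdash M[x:=N]N_1\dots N_n:A$ infer $\Gamma\vdash(\lambda x.M)NN_1\dots N_n:A$. -}

module Defs where

open import Data.Nat using (ℕ; zero; suc; _≟_)
open import Data.List using (List; []; _∷_; foldl; _++_)
open import Data.List.Membership.Propositional using (_∈_; _∉_)
open import Data.List.Relation.Unary.All using (All)
open import Data.Product using (_×_; _,_; ∃-syntax)
open import Function.Bundles using (_⇔_)
open import Relation.Nullary using (yes; no)

data Ty : Set where
  atom : ℕ → Ty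
  ω    : Ty
  _⇒_  : Ty → Ty → Ty
  _∩_  : Ty → Ty → Ty

infixr 7 _⇒_
infixr 8 _∩_

-- λ-terms modulo α-conversion, in locally nameless representation:
-- bound variables are de Bruijn indices, free variables are names in ℕ.
data Tm : Set where
  bvar : ℕ → Tm
  fvar : ℕ → Tm
  app  : Tm → Tm → Tm
  lam  : Tm → Tm

apps : Tm → List Tm → Tm
apps = foldl app

openAt : ℕ → Tm → Tm → Tm
openAt k u (bvar i) with k ≟ i
... | yes _ = u
... | no  _ = bvar i
openAt k u (fvar x)  = fvar x
openAt k u (app s t) = app (openAt k u s) (openAt k u t)
openAt k u (lam t)   = lam (openAt (suc k) u t)

-- for a body t of λx.M:  t ^ N  is  M[x := N]
_^_ : Tm → Tm → Tm
t ^ u = openAt 0 u t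

-- locally closed terms at depth k (= genuine λ-terms when k = 0)
data LCAt : ℕ → Tm → Set where
  lc-bvar : ∀ {k i} → Data.Nat._<_ i k → LCAt k (bvar i)
  lc-fvar : ∀ {k x} → LCAt k (fvar x)
  lc-app  : ∀ {k s t} → LCAt k s → LCAt k t → LCAt k (app s t)
  lc-lam  : ∀ {k t} → LCAt (suc k) t → LCAt k (lam t)

LC : Tm → Set
LC = LCAt 0

fv : Tm → List ℕ
fv (bvar _)  = []
fv (fvar x)  = x ∷ []
fv (app s t) = fv s ++ fv t
fv (lam t)   = fv t

-- Typing contexts: finite sets of pairs x : A, represented as lists,
-- considered up to set equality (same members).
Ctx : Set
Ctx = List (ℕ × Ty)

_≋_ : Ctx → Ctx → Set
Γ ≋ Δ = ∀ p → (p ∈ Γ) ⇔ (p ∈ Δ)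

_∉dom_ : ℕ → Ctx → Set
x ∉dom Γ = ∀ C → (x , C) ∉ Γ

data Sys : Set where
  s ℓ : Sys

-- Derivability  Δ ⊢ M : A  in Λ^s_{∩ω} (sys = s) or Λ^ℓ_{∩ω} (sys = ℓ).
-- A conclusion "Γ , x : A ⊢ …" is rendered as any Δ with Δ ≋ (x , A) ∷ Γ.
infix 4 _⊢[_]_∶_
data _⊢[_]_∶_ : Ctx → Sys → Tm → Ty → Set where
  Ax   : ∀ {sys Γ Δ x A} → Δ ≋ ((x , A) ∷ Γ) →
         Δ ⊢[ sys ] fvar x ∶ A
  Beta-s : ∀ {Γ t N Ns A B} → LC (apps (app (lam t) N) Ns) →
         Γ ⊢[ s ] apps (t ^ N) Ns ∶ A →
         Γ ⊢[ s ] N ∶ B →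
         Γ ⊢[ s ] apps (app (lam t) N) Ns ∶ A
  Beta-ℓ : ∀ {Γ t N Ns A} → LC (apps (app (lam t) N) Ns) →
         Γ ⊢[ ℓ ] apps (t ^ N) Ns ∶ A →
         Γ ⊢[ ℓ ] apps (app (lam t) N) Ns ∶ A
  L⇒   : ∀ {sys Γ Δ x y N Ns A₁ A₂ B} → Δ ≋ ((x , A₁ ⇒ A₂) ∷ Γ) →
         Γ ⊢[ sys ] N ∶ A₁ →
         ((y , A₂) ∷ Γ) ⊢[ sys ] apps (fvar y) Ns ∶ B →
         All (λ Nᵢ → y ∉ fv Nᵢ) Ns →
         y ∉dom Γ →
         Δ ⊢[ sys ] apps (fvar x) (N ∷ Ns) ∶ B
  R⇒   : ∀ {sys Γ x t A B} →
         ((x , A) ∷ Γ) ⊢[ sys ] t ^ fvar x ∶ B →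
         x ∉dom Γ →
         x ∉ fv t →
         Γ ⊢[ sys ] lam t ∶ A ⇒ B
  L∩   : ∀ {sys Γ Δ x Ns A₁ A₂ B} → Δ ≋ ((x , A₁ ∩ A₂) ∷ Γ) →
         ((x , A₁) ∷ (x , A₂) ∷ Γ) ⊢[ sys ] apps (fvar x) Ns ∶ B →
         Δ ⊢[ sys ] apps (fvar x) Ns ∶ B
  R∩   : ∀ {sys Γ M A B} →
         Γ ⊢[ sys ] M ∶ A → Γ ⊢[ sys ] M ∶ B → Γ ⊢[ sys ] M ∶ A ∩ B
  ω-I  : ∀ {sys Γ M} → LC M → Γ ⊢[ sys ] M ∶ ω

-- The two systems differ only in Beta. Forgetting the premise on N turns
-- Beta^s into Beta^ℓ; conversely the missing premise Γ ⊢ N : B is supplied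
-- by rule ω with B = ω, which only needs N to be a λ-term, and that is
-- guaranteed by the local-closure side condition of Beta^ℓ.
module Submission where

open import Defs
open import Function.Bundles using (_⇔_; mk⇔)
open import Data.List using (List; []; _∷_)

lcAt-apps-head : ∀ {k M} (Ns : List Tm) → LCAt k (apps M Ns) → LCAt k M
lcAt-apps-head []       lcM = lcM
lcAt-apps-head (_ ∷ Ns) lcM with lcAt-apps-head Ns lcM
... | lc-app lcM′ _ = lcM′

lc-redex-argument : ∀ {t N} Ns → LC (apps (app (lam t) N) Ns) → LC N
lc-redex-argument Ns lcM with lcAt-apps-head Ns lcM
... | lc-app _ lcN = lcN

⊢s⇒⊢ℓ : ∀ {Γ M A} → Γ ⊢[ s ] M ∶ A → Γ ⊢[ ℓ ] M ∶ A
⊢s⇒⊢ℓ (Ax Δ≋)                          = Ax Δ≋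
⊢s⇒⊢ℓ (Beta-s {t = t} {N} {Ns} lc d _) = Beta-ℓ {t = t} {N} {Ns} lc (⊢s⇒⊢ℓ d)
⊢s⇒⊢ℓ (L⇒ {x = x} {y} {N} {Ns} Δ≋ dN dy y∉Ns y∉Γ) =
  L⇒ {x = x} {y} {N} {Ns} Δ≋ (⊢s⇒⊢ℓ dN) (⊢s⇒⊢ℓ dy) y∉Ns y∉Γ
⊢s⇒⊢ℓ (R⇒ d x∉Γ x∉t)                   = R⇒ (⊢s⇒⊢ℓ d) x∉Γ x∉t
⊢s⇒⊢ℓ (L∩ {x = x} {Ns} Δ≋ d)           = L∩ {x = x} {Ns} Δ≋ (⊢s⇒⊢ℓ d)
⊢s⇒⊢ℓ (R∩ d₁ d₂)                       = R∩ (⊢s⇒⊢ℓ d₁) (⊢s⇒⊢ℓ d₂)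
⊢s⇒⊢ℓ (ω-I lc)                         = ω-I lc

⊢ℓ⇒⊢s : ∀ {Γ M A} → Γ ⊢[ ℓ ] M ∶ A → Γ ⊢[ s ] M ∶ A
⊢ℓ⇒⊢s (Ax Δ≋)                        = Ax Δ≋
⊢ℓ⇒⊢s (Beta-ℓ {t = t} {N} {Ns} lc d) =
  Beta-s {t = t} {N} {Ns} lc (⊢ℓ⇒⊢s d) (ω-I (lc-redex-argument Ns lc))
⊢ℓ⇒⊢s (L⇒ {x = x} {y} {N} {Ns} Δ≋ dN dy y∉Ns y∉Γ) =
  L⇒ {x = x} {y} {N} {Ns} Δ≋ (⊢ℓ⇒⊢s dN) (⊢ℓ⇒⊢s dy) y∉Ns y∉Γ
⊢ℓ⇒⊢s (R⇒ d x∉Γ x∉t)                 = R⇒ (⊢ℓ⇒⊢s d) x∉Γ x∉t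
⊢ℓ⇒⊢s (L∩ {x = x} {Ns} Δ≋ d)         = L∩ {x = x} {Ns} Δ≋ (⊢ℓ⇒⊢s d)
⊢ℓ⇒⊢s (R∩ d₁ d₂)                     = R∩ (⊢ℓ⇒⊢s d₁) (⊢ℓ⇒⊢s d₂)
⊢ℓ⇒⊢s (ω-I lc)                       = ω-I lc

lemma11 : (Γ : Ctx) (M : Tm) (A : Ty) → LC M →
          (Γ ⊢[ s ] M ∶ A) ⇔ (Γ ⊢[ ℓ ] M ∶ A)
lemma11 Γ M A _ = mk⇔ ⊢s⇒⊢ℓ ⊢ℓ⇒⊢s
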